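{- For $n\ge1$, $$|\Pi_n(1/234)|=\sum_{\ell=1}^{n}M(n-\ell)+\sum_{\ell=1}^{n-2}(n-\ell-1)\,M(n-\ell-1)+\sum_{\ell=1}^{n-3}\binom{n-\ell-1}{2}M(n-\ell-2),$$ where $M(m)=\sum_{k=0}^{\lfloor m/2\rfloor}\binom{m}{2k}(2k-1)!!$ is the number of set partitions of an $m$-element set into blocks of size at most $2$ (with $(-1)!!=1$).
   Context: The standardization of a set partition of a finite set $S\subset\mathbb{Z}_{>0}$ replaces the $i$-th smallest element of $S$ by $i$. A set partition $\pi$ of $[n]$ contains $\tau\vdash[k]$ if for some $S\subseteq[n]$ the standardization of the restriction of $\pi$ to $S$ is $\tau$; otherwise it avoids $\tau$. $\Pi_n(\tau)$ is the set of partitions of $[n]$ avoiding $\tau$. $1/234$ is the partition of $[4]$ with blocks $\{1\},\{2,3,4\}$. -}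

module Defs where

open import Data.Nat using (ℕ; zero; suc; _+_; _*_; _∸_; _/_)
open import Data.Nat.Combinatorics using (_C_)
open import Data.Bool using (Bool; true; false)
open import Data.Fin using (Fin; zero; suc; _<_)
open import Data.Vec using (Vec; []; _∷_; lookup)
open import Data.List using (List; map; applyUpTo; length)
open import Data.Nat.ListAction using (sum)
open import Data.List.Membership.Propositional using (_∈_)
open import Data.List.Relation.Unary.Unique.Propositional using (Unique)
open import Data.Product using (Σ; _×_; ∃)
open import Relation.Binary.PropositionalEquality using (_≡_)
open import Relation.Nullary using (¬_)
open import Function.Bundles using (_⇔_)

-- Set partitions of [n] = {1,…,n} (encoded as Fin n, element i+1 ↦ i),
-- given by their "same block" relation as an n×n Boolean matrix.

Rel : ℕ → Set
Rel n = Vec (Vec Bool n) n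

rel : ∀ {n} → Rel n → Fin n → Fin n → Bool
rel R i j = lookup (lookup R i) j

record IsSetPartition {n : ℕ} (R : Rel n) : Set where
  field
    reflexive  : ∀ i → rel R i i ≡ true
    symmetric  : ∀ i j → rel R i j ≡ true → rel R j i ≡ true
    transitive : ∀ i j k → rel R i j ≡ true → rel R j k ≡ true → rel R i k ≡ true

Contains : ∀ {n k} → Rel n → Rel k → Set
Contains {n} {k} π τ =
  Σ (Fin k → Fin n) λ s →
    (∀ i j → i < j → s i < s j) ×
    (∀ i j → rel π (s i) (s j) ≡ rel τ i j)

Avoids : ∀ {n k} → Rel n → Rel k → Set
Avoids π τ = ¬ Contains π τ

InΠ : (n : ℕ) → ∀ {k} → Rel k → Rel n → Set
InΠ n τ π = IsSetPartition π × Avoids π τ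

HasCard : {A : Set} → (A → Set) → ℕ → Set
HasCard {A} P N =
  Σ (List A) λ L → Unique L × (∀ x → (x ∈ L) ⇔ P x) × length L ≡ N

p1/234 : Rel 4
p1/234 =
  (true  ∷ false ∷ false ∷ false ∷ []) ∷
  (false ∷ true  ∷ true  ∷ true  ∷ []) ∷
  (false ∷ true  ∷ true  ∷ true  ∷ []) ∷
  (false ∷ true  ∷ true  ∷ true  ∷ []) ∷ []

-- oddDF k = (2k-1)!!, with (-1)!! = 1.
oddDF : ℕ → ℕ
oddDF zero    = 1
oddDF (suc k) = (suc (2 * k)) * oddDF k

sum1to : ℕ → (ℕ → ℕ) → ℕ
sum1to b f = sum (map f (applyUpTo suc b))

sum0to : ℕ → (ℕ → ℕ) → ℕ
sum0to b f = sum (map f (applyUpTo (λ k → k) (suc b)))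

M : ℕ → ℕ
M m = sum0to (m / 2) (λ k → (m C (2 * k)) * oddDF k)

RHS : ℕ → ℕ
RHS n =
  sum1to n (λ ℓ → M (n ∸ ℓ))
  + sum1to (n ∸ 2) (λ ℓ → (n ∸ ℓ ∸ 1) * M (n ∸ ℓ ∸ 1))
  + sum1to (n ∸ 3) (λ ℓ → ((n ∸ ℓ ∸ 1) C 2) * M (n ∸ ℓ ∸ 2))

-- Write [n] = {1, …, n} and let π be a partition of [n] avoiding 1/234. If 1 and 2 share a block,
-- deleting 1 leaves an arbitrary 1/234-avoiding partition of {2, …, n}. Otherwise a block with three
-- elements must contain 1 (else 1 completes an occurrence) and at most two elements besides it (else
-- 2 does), so π restricted to {2, …, n} is a matching, and the block of 1 is {1}, {1, j} for a
-- singleton {j} ≠ {2} of that matching, or {1, j, k} for a pair {j, k} of it avoiding 2. Conversely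
-- all of these avoid 1/234; they number M(n-1) + (n-2) M(n-2) + C(n-2,2) M(n-3), and unrolling the
-- first case gives the formula. The counts are bijective: each case is parametrised by explicit data
-- (partners and smaller matchings) that decode injectively onto exactly these partitions.

module Submission where

open import Defs
open import Data.Nat as ℕ using (ℕ; zero; suc; _+_; _*_; _∸_; _/_; _%_; _≥_; z≤n; s≤s)
open import Data.Nat.Properties
  using ( +-comm; +-assoc; *-comm; *-assoc; *-suc; *-zeroʳ; *-identityˡ; *-identityʳ; *-distribˡ-+; *-distribʳ-+
        ; *-cancelˡ-≡; +-monoˡ-<; *-monoˡ-≤; ≤-trans; n≤1+n; module ≤-Reasoning)
open import Data.Nat.DivMod using (m≡m%n+[m/n]*n; m%n<n; m/n≤m)
open import Data.Nat.Combinatorics using (_C_; nCk+nC[k+1]≡[n+1]C[k+1]; nC1≡n; k>n⇒nCk≡0)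
open import Data.Nat.ListAction using (sum)
open import Data.Nat.Tactic.RingSolver using (solve-∀)
open import Data.Bool using (Bool; true; false)
open import Data.Bool.Properties using (¬-not; not-¬) renaming (_≟_ to _≟ᵇ_)
open import Data.Fin using (Fin; zero; suc; _<_; punchIn)
open import Data.Fin.Patterns using (0F; 1F; 2F; 3F)
open import Data.Fin.Properties
  using (_≟_; <-cmp; <-irrefl; <-trans; any?; suc-injective; 0≢1+n; punchIn-injective; punchInᵢ≢i; punchIn-punchOut)
open import Data.Maybe as Maybe using (Maybe; nothing; just; maybe′)
open import Data.List using (List; []; _∷_; map; _++_; length; applyUpTo; cartesianProduct; allFin)
open import Data.List.Properties using (map-applyUpTo; map-cong; length-map; length-++; length-tabulate)
open import Data.List.Membership.Propositional using (_∈_)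
open import Data.List.Membership.Propositional.Properties
  using (∈-map⁺; ∈-map⁻; ∈-++⁺ˡ; ∈-++⁺ʳ; ∈-cartesianProduct⁺; ∈-allFin)
open import Data.List.Relation.Unary.Any using (here)
open import Data.List.Relation.Unary.All using ([])
open import Data.List.Relation.Unary.AllPairs using ([]; _∷_)
open import Data.List.Relation.Unary.Unique.Propositional using (Unique)
open import Data.List.Relation.Unary.Unique.Propositional.Properties using (map⁺; ++⁺; cartesianProduct⁺; allFin⁺)
open import Data.Vec using (tabulate; lookup)
open import Data.Vec.Properties using (lookup∘tabulate; tabulate∘lookup; tabulate-cong)
open import Data.Product using (_×_; _,_; ∃; proj₁; proj₂; uncurry)
open import Data.Sum as Sum using (_⊎_; inj₁; inj₂)
open import Data.Sum.Properties using (inj₁-injective; inj₂-injective)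
open import Data.Unit using (⊤; tt)
open import Data.Empty using (⊥; ⊥-elim)
open import Function using (_∘_; _on_; case_of_)
open import Function.Bundles using (mk⇔)
open import Function.Definitions using (Injective)
open import Relation.Binary.Definitions using (Tri; tri<; tri≈; tri>)
open import Relation.Binary.PropositionalEquality
open import Relation.Nullary using (¬_; Dec; yes; no; contradiction)

private variable
  A B : Set
  n : ℕ

-- The recurrences for M and for the right-hand side

[1+k]*[1+n]C[1+k]≡[1+n]*nCk : ∀ n k → suc k * (suc n C suc k) ≡ suc n * (n C k)
[1+k]*[1+n]C[1+k]≡[1+n]*nCk zero    zero    = refl
[1+k]*[1+n]C[1+k]≡[1+n]*nCk zero    (suc k) = begin
  suc (suc k) * (1 C suc (suc k)) ≡⟨ cong (suc (suc k) *_) (k>n⇒nCk≡0 {1} {suc (suc k)} (s≤s (s≤s z≤n))) ⟩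
  suc (suc k) * 0                 ≡⟨ *-zeroʳ (suc (suc k)) ⟩
  0                               ≡⟨ cong (_+ 0) (k>n⇒nCk≡0 {0} {suc k} (s≤s z≤n)) ⟨
  1 * (0 C suc k)                 ∎
  where open ≡-Reasoning
[1+k]*[1+n]C[1+k]≡[1+n]*nCk (suc n) zero    = begin
  1 * (suc (suc n) C 1) ≡⟨ *-identityˡ _ ⟩
  suc (suc n) C 1       ≡⟨ nC1≡n (suc (suc n)) ⟩
  suc (suc n)           ≡⟨ *-identityʳ (suc (suc n)) ⟨
  suc (suc n) * 1       ∎
  where open ≡-Reasoning
[1+k]*[1+n]C[1+k]≡[1+n]*nCk (suc n) (suc k) = begin
  suc (suc k) * (suc (suc n) C suc (suc k))
    ≡⟨ cong (suc (suc k) *_) (nCk+nC[k+1]≡[n+1]C[k+1] (suc n) (suc k)) ⟨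
  suc (suc k) * (a + b)
    ≡⟨ distribute k a b ⟩
  (suc k * a + suc (suc k) * b) + a
    ≡⟨ cong₂ (λ x y → x + y + a) ([1+k]*[1+n]C[1+k]≡[1+n]*nCk n k) ([1+k]*[1+n]C[1+k]≡[1+n]*nCk n (suc k)) ⟩
  (suc n * (n C k) + suc n * (n C suc k)) + a
    ≡⟨ cong (_+ a) (*-distribˡ-+ (suc n) (n C k) (n C suc k)) ⟨
  suc n * (n C k + n C suc k) + a
    ≡⟨ cong (λ x → suc n * x + a) (nCk+nC[k+1]≡[n+1]C[k+1] n k) ⟩
  suc n * a + a
    ≡⟨ +-comm (suc n * a) a ⟩
  suc (suc n) * a ∎
  where
  open ≡-Reasoning
  a = suc n C suc k
  b = suc n C suc (suc k)
  distribute : ∀ k a b → suc (suc k) * (a + b) ≡ (suc k * a + suc (suc k) * b) + a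
  distribute = solve-∀

sum0to-suc : ∀ K f → sum0to (suc K) f ≡ f 0 + sum0to K (f ∘ suc)
sum0to-suc K f = cong (λ xs → f 0 + sum xs)
  (trans (map-applyUpTo suc f (suc K)) (sym (map-applyUpTo (λ k → k) (f ∘ suc) (suc K))))

sum0to-cong : ∀ K {f g} → (∀ k → f k ≡ g k) → sum0to K f ≡ sum0to K g
sum0to-cong K f≗g = cong sum (map-cong f≗g (applyUpTo (λ k → k) (suc K)))

sum0to-linear : ∀ K c f g → sum0to K (λ k → f k + c * g k) ≡ sum0to K f + c * sum0to K g
sum0to-linear zero    c f g = regroup (f 0) (g 0) c
  where
  regroup : ∀ a b c → a + c * b + 0 ≡ a + 0 + c * (b + 0)
  regroup = solve-∀
sum0to-linear (suc K) c f g = begin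
  sum0to (suc K) (λ k → f k + c * g k)
    ≡⟨ sum0to-suc K (λ k → f k + c * g k) ⟩
  f 0 + c * g 0 + sum0to K (λ k → f (suc k) + c * g (suc k))
    ≡⟨ cong (f 0 + c * g 0 +_) (sum0to-linear K c (f ∘ suc) (g ∘ suc)) ⟩
  f 0 + c * g 0 + (sum0to K (f ∘ suc) + c * sum0to K (g ∘ suc))
    ≡⟨ regroup (f 0) (g 0) (sum0to K (f ∘ suc)) (sum0to K (g ∘ suc)) c ⟩
  (f 0 + sum0to K (f ∘ suc)) + c * (g 0 + sum0to K (g ∘ suc))
    ≡⟨ cong₂ (λ x y → x + c * y) (sum0to-suc K f) (sum0to-suc K g) ⟨
  sum0to (suc K) f + c * sum0to (suc K) g ∎
  where
  open ≡-Reasoning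
  regroup : ∀ a b s t c → a + c * b + (s + c * t) ≡ (a + s) + c * (b + t)
  regroup = solve-∀

sum0to-zero : ∀ K f → (∀ k → f k ≡ 0) → sum0to K f ≡ 0
sum0to-zero zero    f f≡0 = cong (_+ 0) (f≡0 0)
sum0to-zero (suc K) f f≡0 = trans (sum0to-suc K f) (cong₂ _+_ (f≡0 0) (sum0to-zero K (f ∘ suc) (f≡0 ∘ suc)))

sum0to-vanishing : ∀ {K K'} f → K ℕ.≤ K' → (∀ k → K ℕ.< k → f k ≡ 0) → sum0to K' f ≡ sum0to K f
sum0to-vanishing {K' = zero}   f z≤n       vanish = refl
sum0to-vanishing {K' = suc K'} f z≤n       vanish = begin
  sum0to (suc K') f          ≡⟨ sum0to-suc K' f ⟩
  f 0 + sum0to K' (f ∘ suc)  ≡⟨ cong (f 0 +_) (sum0to-zero K' (f ∘ suc) (λ k → vanish (suc k) (s≤s z≤n))) ⟩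
  f 0 + 0                    ∎
  where open ≡-Reasoning
sum0to-vanishing f (s≤s {K} {K'} K≤K') vanish = begin
  sum0to (suc K') f          ≡⟨ sum0to-suc K' f ⟩
  f 0 + sum0to K' (f ∘ suc)  ≡⟨ cong (f 0 +_) (sum0to-vanishing (f ∘ suc) K≤K' (λ k → vanish (suc k) ∘ s≤s)) ⟩
  f 0 + sum0to K (f ∘ suc)   ≡⟨ sum0to-suc K f ⟨
  sum0to (suc K) f           ∎
  where open ≡-Reasoning

matchingsWith : ℕ → ℕ → ℕ
matchingsWith n k = (n C (2 * k)) * oddDF k

n/2<k⇒n<2*k : ∀ {n k} → n / 2 ℕ.< k → n ℕ.< 2 * k
n/2<k⇒n<2*k {n} {k} n/2<k = begin-strict
  n                  ≡⟨ m≡m%n+[m/n]*n n 2 ⟩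
  n % 2 + n / 2 * 2  <⟨ +-monoˡ-< (n / 2 * 2) (m%n<n n 2) ⟩
  suc (n / 2) * 2    ≤⟨ *-monoˡ-≤ 2 n/2<k ⟩
  k * 2              ≡⟨ *-comm k 2 ⟩
  2 * k              ∎
  where open ≤-Reasoning

M≡sum0to : ∀ n {K} → n / 2 ℕ.≤ K → M n ≡ sum0to K (matchingsWith n)
M≡sum0to n n/2≤K = sym (sum0to-vanishing (matchingsWith n) n/2≤K
  (λ k n/2<k → cong (_* oddDF k) (k>n⇒nCk≡0 (n/2<k⇒n<2*k n/2<k))))

matchingsWith-rec : ∀ n k →
  matchingsWith (suc (suc n)) (suc k) ≡ matchingsWith (suc n) (suc k) + suc n * matchingsWith n k
matchingsWith-rec n k = begin
  (suc (suc n) C (2 * suc k)) * oddDF (suc k)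
    ≡⟨ cong (λ i → (suc (suc n) C i) * oddDF (suc k)) (*-suc 2 k) ⟩
  (suc (suc n) C suc (suc (2 * k))) * (suc (2 * k) * oddDF k)
    ≡⟨ cong (_* (suc (2 * k) * oddDF k)) (nCk+nC[k+1]≡[n+1]C[k+1] (suc n) (suc (2 * k))) ⟨
  (a + b) * (suc (2 * k) * oddDF k)
    ≡⟨ regroup a b (suc (2 * k)) (oddDF k) ⟩
  b * (suc (2 * k) * oddDF k) + (suc (2 * k) * a) * oddDF k
    ≡⟨ cong₂ (λ i x → (suc n C i) * oddDF (suc k) + x * oddDF k)
             (sym (*-suc 2 k)) ([1+k]*[1+n]C[1+k]≡[1+n]*nCk n (2 * k)) ⟩
  (suc n C (2 * suc k)) * oddDF (suc k) + (suc n * (n C (2 * k))) * oddDF k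
    ≡⟨ cong (matchingsWith (suc n) (suc k) +_) (*-assoc (suc n) (n C (2 * k)) (oddDF k)) ⟩
  matchingsWith (suc n) (suc k) + suc n * matchingsWith n k ∎
  where
  open ≡-Reasoning
  a = suc n C suc (2 * k)
  b = suc n C suc (suc (2 * k))
  regroup : ∀ a b c d → (a + b) * (c * d) ≡ b * (c * d) + (c * a) * d
  regroup = solve-∀

sum0to-matchingsWith-rec : ∀ n K →
  sum0to (suc K) (matchingsWith (suc (suc n)))
    ≡ sum0to (suc K) (matchingsWith (suc n)) + suc n * sum0to K (matchingsWith n)
sum0to-matchingsWith-rec n K = begin
  sum0to (suc K) (matchingsWith (suc (suc n)))
    ≡⟨ sum0to-suc K (matchingsWith (suc (suc n))) ⟩
  1 + sum0to K (matchingsWith (suc (suc n)) ∘ suc)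
    ≡⟨ cong (1 +_) (sum0to-cong K (matchingsWith-rec n)) ⟩
  1 + sum0to K (λ k → matchingsWith (suc n) (suc k) + suc n * matchingsWith n k)
    ≡⟨ cong (1 +_) (sum0to-linear K (suc n) (matchingsWith (suc n) ∘ suc) (matchingsWith n)) ⟩
  1 + (sum0to K (matchingsWith (suc n) ∘ suc) + suc n * sum0to K (matchingsWith n))
    ≡⟨ +-assoc 1 (sum0to K (matchingsWith (suc n) ∘ suc)) (suc n * sum0to K (matchingsWith n)) ⟨
  1 + sum0to K (matchingsWith (suc n) ∘ suc) + suc n * sum0to K (matchingsWith n)
    ≡⟨ cong (_+ suc n * sum0to K (matchingsWith n)) (sum0to-suc K (matchingsWith (suc n))) ⟨
  sum0to (suc K) (matchingsWith (suc n)) + suc n * sum0to K (matchingsWith n) ∎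
  where open ≡-Reasoning

-- Sum the termwise recurrence over a range of k long enough for all three values of M.
M-rec : ∀ n → M (suc (suc n)) ≡ M (suc n) + suc n * M n
M-rec n = begin
  M (suc (suc n))
    ≡⟨ M≡sum0to (suc (suc n)) (m/n≤m (suc (suc n)) 2) ⟩
  sum0to (suc (suc n)) (matchingsWith (suc (suc n)))
    ≡⟨ sum0to-matchingsWith-rec n (suc n) ⟩
  sum0to (suc (suc n)) (matchingsWith (suc n)) + suc n * sum0to (suc n) (matchingsWith n)
    ≡⟨ cong₂ (λ x y → x + suc n * y) (M≡sum0to (suc n) (≤-trans (m/n≤m (suc n) 2) (n≤1+n (suc n))))
                                     (M≡sum0to n (≤-trans (m/n≤m n 2) (n≤1+n n))) ⟨
  M (suc n) + suc n * M n ∎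
  where open ≡-Reasoning

2*[1+n]C2≡[1+n]*n : ∀ n → 2 * (suc n C 2) ≡ suc n * n
2*[1+n]C2≡[1+n]*n n = trans ([1+k]*[1+n]C[1+k]≡[1+n]*nCk n 1) (cong (suc n *_) (nC1≡n n))

[1+n]C2≡n+nC2 : ∀ n → suc n C 2 ≡ n + n C 2
[1+n]C2≡n+nC2 n = trans (sym (nCk+nC[k+1]≡[n+1]C[k+1] n 1)) (cong (_+ n C 2) (nC1≡n n))

[3+k]C2*[1+k]≡[3+k]*[2+k]C2 : ∀ k → ((3 + k) C 2) * suc k ≡ (3 + k) * ((2 + k) C 2)
[3+k]C2*[1+k]≡[3+k]*[2+k]C2 k = *-cancelˡ-≡ _ _ 2 (begin
  2 * (((3 + k) C 2) * suc k)   ≡⟨ *-assoc 2 ((3 + k) C 2) (suc k) ⟨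
  2 * ((3 + k) C 2) * suc k     ≡⟨ cong (_* suc k) (2*[1+n]C2≡[1+n]*n (2 + k)) ⟩
  (3 + k) * (2 + k) * suc k   ≡⟨ *-assoc (3 + k) (2 + k) (suc k) ⟩
  (3 + k) * ((2 + k) * suc k) ≡⟨ cong ((3 + k) *_) (2*[1+n]C2≡[1+n]*n (suc k)) ⟨
  (3 + k) * (2 * ((2 + k) C 2)) ≡⟨ *-comm (3 + k) (2 * ((2 + k) C 2)) ⟩
  2 * ((2 + k) C 2) * (3 + k)   ≡⟨ *-assoc 2 ((2 + k) C 2) (3 + k) ⟩
  2 * (((2 + k) C 2) * (3 + k)) ≡⟨ cong (2 *_) (*-comm ((2 + k) C 2) (3 + k)) ⟩
  2 * ((3 + k) * ((2 + k) C 2)) ∎)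
  where open ≡-Reasoning

firstUnmarked-count : ∀ n → (suc n C 2) * M (n ∸ 1) + suc n * ((n C 2) * M (n ∸ 2)) ≡ (suc n C 2) * M n
firstUnmarked-count zero          = refl
firstUnmarked-count (suc zero)    = refl
firstUnmarked-count (suc (suc k)) = begin
  c * M (suc k) + (3 + k) * (((2 + k) C 2) * M k)
    ≡⟨ cong (c * M (suc k) +_) (*-assoc (3 + k) ((2 + k) C 2) (M k)) ⟨
  c * M (suc k) + (3 + k) * ((2 + k) C 2) * M k
    ≡⟨ cong (λ x → c * M (suc k) + x * M k) ([3+k]C2*[1+k]≡[3+k]*[2+k]C2 k) ⟨
  c * M (suc k) + c * suc k * M k
    ≡⟨ cong (c * M (suc k) +_) (*-assoc c (suc k) (M k)) ⟩
  c * M (suc k) + c * (suc k * M k)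
    ≡⟨ *-distribˡ-+ c (M (suc k)) (suc k * M k) ⟨
  c * (M (suc k) + suc k * M k)
    ≡⟨ cong (c *_) (M-rec k) ⟨
  c * M (suc (suc k)) ∎
  where
  open ≡-Reasoning
  c = (3 + k) C 2

sum1to-suc : ∀ b f → sum1to (suc b) f ≡ f 1 + sum1to b (f ∘ suc)
sum1to-suc b f = cong (λ xs → f 1 + sum xs)
  (trans (map-applyUpTo (λ ℓ → suc (suc ℓ)) f b) (sym (map-applyUpTo suc (f ∘ suc) b)))

RHS-rec : ∀ m → RHS (suc m) + (M (suc m) + (m * M m + (m C 2) * M (m ∸ 1))) ≡ RHS (suc (suc m))
RHS-rec m = begin
  (s₁ + s₂ + s₃) + (M (suc m) + (m * M m + (m C 2) * M (m ∸ 1)))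
    ≡⟨ regroup s₁ s₂ s₃ (M (suc m)) (m * M m) ((m C 2) * M (m ∸ 1)) ⟩
  (M (suc m) + s₁) + (m * M m + s₂) + ((m C 2) * M (m ∸ 1) + s₃)
    ≡⟨ cong₂ (λ x y → (M (suc m) + s₁) + x + y) (second m) (third m) ⟨
  (M (suc m) + s₁) + second-sum (suc (suc m)) + third-sum (suc (suc m))
    ≡⟨ cong (λ x → x + second-sum (suc (suc m)) + third-sum (suc (suc m)))
            (sum1to-suc (suc m) (λ ℓ → M (suc (suc m) ∸ ℓ))) ⟨
  RHS (suc (suc m)) ∎
  where
  open ≡-Reasoning
  second-sum third-sum : ℕ → ℕ
  second-sum n = sum1to (n ∸ 2) (λ ℓ → (n ∸ ℓ ∸ 1) * M (n ∸ ℓ ∸ 1))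
  third-sum n = sum1to (n ∸ 3) (λ ℓ → ((n ∸ ℓ ∸ 1) C 2) * M (n ∸ ℓ ∸ 2))
  s₁ = sum1to (suc m) (λ ℓ → M (suc m ∸ ℓ))
  s₂ = second-sum (suc m)
  s₃ = third-sum (suc m)
  second : ∀ m → second-sum (suc (suc m)) ≡ m * M m + second-sum (suc m)
  second zero    = refl
  second (suc k) = sum1to-suc k (λ ℓ → (3 + k ∸ ℓ ∸ 1) * M (3 + k ∸ ℓ ∸ 1))
  third : ∀ m → third-sum (suc (suc m)) ≡ (m C 2) * M (m ∸ 1) + third-sum (suc m)
  third zero          = refl
  third (suc zero)    = refl
  third (suc (suc k)) = sum1to-suc k (λ ℓ → ((4 + k ∸ ℓ ∸ 1) C 2) * M (4 + k ∸ ℓ ∸ 2))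
  regroup : ∀ a b c d e f → (a + b + c) + (d + (e + f)) ≡ (d + a) + (e + b) + (f + c)
  regroup = solve-∀

BoolRel : Set → Set
BoolRel A = A → A → Bool

_≗₂_ : BoolRel A → BoolRel A → Set
P ≗₂ Q = ∀ x y → P x y ≡ Q x y

≗₂-sym : ∀ {P Q : BoolRel A} → P ≗₂ Q → Q ≗₂ P
≗₂-sym P≗Q x y = sym (P≗Q x y)

record IsPartition (P : BoolRel A) : Set where
  field
    reflexive  : ∀ x → P x x ≡ true
    symmetric  : ∀ x y → P x y ≡ true → P y x ≡ true
    transitive : ∀ x y z → P x y ≡ true → P y z ≡ true → P x z ≡ true

open IsPartition

empty-isPartition : (P : BoolRel (Fin 0)) → IsPartition P
empty-isPartition P = record { reflexive = λ () ; symmetric = λ () ; transitive = λ () }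

module _ {P : BoolRel A} (isP : IsPartition P) where

  symmetric-≡ : ∀ x y → P x y ≡ P y x
  symmetric-≡ x y with P x y in xy | P y x in yx
  ... | true  | true  = refl
  ... | false | false = refl
  ... | true  | false = trans (sym (symmetric isP x y xy)) yx
  ... | false | true  = trans (sym xy) (symmetric isP y x yx)

  related-rows : ∀ {x y} z → P x y ≡ true → P x z ≡ P y z
  related-rows {x} {y} z xy with P x z in xz | P y z in yz
  ... | true  | true  = refl
  ... | false | false = refl
  ... | true  | false = trans (sym (transitive isP y x z (symmetric isP x y xy) xz)) yz
  ... | false | true  = trans (sym xz) (transitive isP x y z xy yz)

  related-columns : ∀ x {y z} → P y z ≡ true → P x y ≡ P x z
  related-columns x {y} {z} yz = trans (symmetric-≡ x y) (trans (related-rows x yz) (symmetric-≡ z x))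

IsMatching : BoolRel A → Set
IsMatching P = ∀ x y z → P x y ≡ true → P x z ≡ true → x ≡ y ⊎ x ≡ z ⊎ y ≡ z

on-isPartition : ∀ {P : BoolRel B} (f : A → B) → IsPartition P → IsPartition (P on f)
on-isPartition f isP = record
  { reflexive  = λ x → reflexive isP (f x)
  ; symmetric  = λ x y → symmetric isP (f x) (f y)
  ; transitive = λ x y z → transitive isP (f x) (f y) (f z)
  }

on-isMatching : ∀ {P : BoolRel B} {f : A → B} → Injective _≡_ _≡_ f → IsMatching P → IsMatching (P on f)
on-isMatching f-inj isM x y z xy xz = Sum.map f-inj (Sum.map f-inj f-inj) (isM _ _ _ xy xz)

on-cong : ∀ {P Q : BoolRel B} (f : A → B) → P ≗₂ Q → (P on f) ≗₂ (Q on f)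
on-cong f P≗Q x y = P≗Q (f x) (f y)

delete : Fin (suc n) → BoolRel (Fin (suc n)) → BoolRel (Fin n)
delete p P = P on punchIn p

delete-isPartition : ∀ p {P : BoolRel (Fin (suc n))} → IsPartition P → IsPartition (delete p P)
delete-isPartition p = on-isPartition (punchIn p)

delete-isMatching : ∀ p {P : BoolRel (Fin (suc n))} → IsMatching P → IsMatching (delete p P)
delete-isMatching p = on-isMatching (punchIn-injective p _ _)

record Joinable (b : A → Bool) (P : BoolRel A) : Set where
  field
    related : ∀ x y → b x ≡ true → b y ≡ true → P x y ≡ true
    closed  : ∀ x y → b x ≡ true → P x y ≡ true → b y ≡ true

open Joinable

empty-joinable : ∀ (P : BoolRel A) → Joinable (λ _ → false) P
empty-joinable P = record { related = λ _ _ () ; closed = λ _ _ () }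

block-joinable : ∀ {P : BoolRel A} → IsPartition P → ∀ j → Joinable (P j) P
block-joinable isP j = record
  { related = λ x y jx jy → transitive isP x j y (symmetric isP j x jx) jy
  ; closed  = λ x y jx xy → transitive isP j x y jx xy
  }

extend : (A → Bool) → BoolRel A → BoolRel (Maybe A)
extend b P nothing  nothing  = true
extend b P nothing  (just y) = b y
extend b P (just x) nothing  = b x
extend b P (just x) (just y) = P x y

extend-cong : ∀ {b b′ : A → Bool} {P P′ : BoolRel A} →
  (∀ x → b x ≡ b′ x) → P ≗₂ P′ → extend b P ≗₂ extend b′ P′
extend-cong b≗b′ P≗P′ nothing  nothing  = refl
extend-cong b≗b′ P≗P′ nothing  (just y) = b≗b′ y
extend-cong b≗b′ P≗P′ (just x) nothing  = b≗b′ x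
extend-cong b≗b′ P≗P′ (just x) (just y) = P≗P′ x y

module _ {b : A → Bool} {P : BoolRel A} (isP : IsPartition P) (b-joinable : Joinable b P) where

  extend-isPartition : IsPartition (extend b P)
  extend-isPartition = record { reflexive = refl′ ; symmetric = sym′ ; transitive = trans′ }
    where
    refl′ : ∀ u → extend b P u u ≡ true
    refl′ nothing  = refl
    refl′ (just x) = reflexive isP x
    sym′ : ∀ u v → extend b P u v ≡ true → extend b P v u ≡ true
    sym′ nothing  nothing  uv = uv
    sym′ nothing  (just y) uv = uv
    sym′ (just x) nothing  uv = uv
    sym′ (just x) (just y) uv = symmetric isP x y uv
    trans′ : ∀ u v w → extend b P u v ≡ true → extend b P v w ≡ true → extend b P u w ≡ true
    trans′ nothing  nothing  w        uv vw = vw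
    trans′ nothing  (just y) nothing  uv vw = refl
    trans′ nothing  (just y) (just z) uv vw = closed b-joinable y z uv vw
    trans′ (just x) nothing  nothing  uv vw = uv
    trans′ (just x) nothing  (just z) uv vw = related b-joinable x z uv vw
    trans′ (just x) (just y) nothing  uv vw = closed b-joinable y x vw (symmetric isP x y uv)
    trans′ (just x) (just y) (just z) uv vw = transitive isP x y z uv vw

extend-false-isMatching : ∀ {P : BoolRel A} → IsMatching P → IsMatching (extend (λ _ → false) P)
extend-false-isMatching isM nothing  nothing  w        uv uw = inj₁ refl
extend-false-isMatching isM (just x) (just y) (just z) uv uw =
  Sum.map (cong just) (Sum.map (cong just) (cong just)) (isM x y z uv uw)

extend-singleton-isMatching : ∀ {P : BoolRel A} {j} → IsMatching P → (∀ y → P j y ≡ true → y ≡ j) →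
  IsMatching (extend (P j) P)
extend-singleton-isMatching isM single nothing  nothing  w        uv uw = inj₁ refl
extend-singleton-isMatching isM single nothing  (just y) nothing  uv uw = inj₂ (inj₁ refl)
extend-singleton-isMatching isM single nothing  (just y) (just z) uv uw =
  inj₂ (inj₂ (cong just (trans (single y uv) (sym (single z uw)))))
extend-singleton-isMatching isM single (just x) nothing  nothing  uv uw = inj₂ (inj₂ refl)
extend-singleton-isMatching isM single (just x) nothing  (just z) uv uw with single x uv
... | refl = inj₂ (inj₁ (cong just (sym (single z uw))))
extend-singleton-isMatching isM single (just x) (just y) nothing  uv uw with single x uw
... | refl = inj₁ (cong just (sym (single y uv)))
extend-singleton-isMatching isM single (just x) (just y) (just z) uv uw =
  Sum.map (cong just) (Sum.map (cong just) (cong just)) (isM x y z uv uw)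

punchOutMaybe : Fin (suc n) → Fin (suc n) → Maybe (Fin n)
punchOutMaybe zero            zero    = nothing
punchOutMaybe zero            (suc x) = just x
punchOutMaybe {suc n} (suc p) zero    = just zero
punchOutMaybe {suc n} (suc p) (suc x) = Maybe.map suc (punchOutMaybe p x)

punchOutMaybe-self : ∀ (p : Fin (suc n)) → punchOutMaybe p p ≡ nothing
punchOutMaybe-self zero            = refl
punchOutMaybe-self {suc n} (suc p) = cong (Maybe.map suc) (punchOutMaybe-self p)

punchOutMaybe-punchIn : ∀ (p : Fin (suc n)) i → punchOutMaybe p (punchIn p i) ≡ just i
punchOutMaybe-punchIn zero            i       = refl
punchOutMaybe-punchIn {suc n} (suc p) zero    = refl
punchOutMaybe-punchIn {suc n} (suc p) (suc i) = cong (Maybe.map suc) (punchOutMaybe-punchIn p i)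

punchIn-punchOutMaybe : ∀ (p x : Fin (suc n)) → maybe′ (punchIn p) p (punchOutMaybe p x) ≡ x
punchIn-punchOutMaybe zero            zero    = refl
punchIn-punchOutMaybe zero            (suc x) = refl
punchIn-punchOutMaybe {suc n} (suc p) zero    = refl
punchIn-punchOutMaybe {suc n} (suc p) (suc x) with punchOutMaybe p x | punchIn-punchOutMaybe p x
... | nothing | p≡x    = cong suc p≡x
... | just i  | pi≡x   = cong suc pi≡x

punchOutMaybe-injective : ∀ (p : Fin (suc n)) → Injective _≡_ _≡_ (punchOutMaybe p)
punchOutMaybe-injective p {x} {y} eq = begin
  x                                        ≡⟨ punchIn-punchOutMaybe p x ⟨
  maybe′ (punchIn p) p (punchOutMaybe p x) ≡⟨ cong (maybe′ (punchIn p) p) eq ⟩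
  maybe′ (punchIn p) p (punchOutMaybe p y) ≡⟨ punchIn-punchOutMaybe p y ⟩
  y                                        ∎
  where open ≡-Reasoning

data PunchView (p : Fin (suc n)) : Fin (suc n) → Set where
  at      : PunchView p p
  punched : ∀ i → PunchView p (punchIn p i)

punchView : ∀ (p x : Fin (suc n)) → PunchView p x
punchView p x with p ≟ x
... | yes refl = at
... | no p≢x   = subst (PunchView p) (punchIn-punchOut p≢x) (punched _)

insert : Fin (suc n) → (Fin n → Bool) → BoolRel (Fin n) → BoolRel (Fin (suc n))
insert p b P = extend b P on punchOutMaybe p

module _ (p : Fin (suc n)) (b : Fin n → Bool) (P : BoolRel (Fin n)) where

  insert-self : insert p b P p p ≡ true
  insert-self rewrite punchOutMaybe-self p = refl

  insert-row : ∀ j → insert p b P p (punchIn p j) ≡ b j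
  insert-row j rewrite punchOutMaybe-self p | punchOutMaybe-punchIn p j = refl

  delete-insert : delete p (insert p b P) ≗₂ P
  delete-insert i j rewrite punchOutMaybe-punchIn p i | punchOutMaybe-punchIn p j = refl

insert-isMatching : ∀ p {b} {P : BoolRel (Fin n)} → IsMatching (extend b P) → IsMatching (insert p b P)
insert-isMatching p = on-isMatching (punchOutMaybe-injective p)

addSingleton : Fin (suc n) → BoolRel (Fin n) → BoolRel (Fin (suc n))
addSingleton p = insert p (λ _ → false)

prependSingleton : BoolRel (Fin n) → BoolRel (Fin (suc n))
prependSingleton = addSingleton zero

prependTo : Fin n → BoolRel (Fin n) → BoolRel (Fin (suc n))
prependTo j P = insert zero (P j) P

prependPair : Fin (suc n) → BoolRel (Fin n) → BoolRel (Fin (suc (suc n)))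
prependPair j Q = prependTo j (addSingleton j Q)

insert-cong : ∀ p {b b′ : Fin n → Bool} {P P′} →
  (∀ x → b x ≡ b′ x) → P ≗₂ P′ → insert p b P ≗₂ insert p b′ P′
insert-cong p b≗b′ P≗P′ = on-cong (punchOutMaybe p) (extend-cong b≗b′ P≗P′)

insert-delete : ∀ p {P : BoolRel (Fin (suc n))} → IsPartition P →
  insert p (λ i → P p (punchIn p i)) (delete p P) ≗₂ P
insert-delete p {P} isP x y =
  trans (on-maybe (punchOutMaybe p x) (punchOutMaybe p y))
        (cong₂ P (punchIn-punchOutMaybe p x) (punchIn-punchOutMaybe p y))
  where
  on-maybe : ∀ u v → extend (λ i → P p (punchIn p i)) (delete p P) u v ≡ (P on maybe′ (punchIn p) p) u v
  on-maybe nothing  nothing  = sym (reflexive isP p)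
  on-maybe nothing  (just j) = refl
  on-maybe (just i) nothing  = symmetric-≡ isP p (punchIn p i)
  on-maybe (just i) (just j) = refl

addSingleton-isPartition : ∀ p {P : BoolRel (Fin n)} → IsPartition P → IsPartition (addSingleton p P)
addSingleton-isPartition p {P} isP = on-isPartition (punchOutMaybe p) (extend-isPartition isP (empty-joinable P))

prependTo-isPartition : ∀ j {P : BoolRel (Fin n)} → IsPartition P → IsPartition (prependTo j P)
prependTo-isPartition j isP = on-isPartition (punchOutMaybe zero) (extend-isPartition isP (block-joinable isP j))

prependPair-isPartition : ∀ j {Q : BoolRel (Fin n)} → IsPartition Q → IsPartition (prependPair j Q)
prependPair-isPartition j isQ = prependTo-isPartition j (addSingleton-isPartition j isQ)

addSingleton-isMatching : ∀ p {P : BoolRel (Fin n)} → IsMatching P → IsMatching (addSingleton p P)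
addSingleton-isMatching p isM = insert-isMatching p (extend-false-isMatching isM)

addSingleton-singleton : ∀ p (P : BoolRel (Fin n)) {y} → addSingleton p P p y ≡ true → y ≡ p
addSingleton-singleton p P {y} py with punchOutMaybe p y | punchIn-punchOutMaybe p y
... | nothing | p≡y rewrite punchOutMaybe-self p = sym p≡y
... | just i  | _   rewrite punchOutMaybe-self p = contradiction py λ ()

prependPair-isMatching : ∀ j {Q : BoolRel (Fin n)} → IsMatching Q → IsMatching (prependPair j Q)
prependPair-isMatching j {Q} isM =
  insert-isMatching zero (extend-singleton-isMatching (addSingleton-isMatching j isM) (λ y → addSingleton-singleton j Q))

prependPair-partner : ∀ j (Q : BoolRel (Fin n)) → prependPair j Q zero (suc j) ≡ true
prependPair-partner j Q = insert-self j (λ _ → false) Q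

prependPair-partner-unique : ∀ j (Q : BoolRel (Fin n)) {y} → prependPair j Q zero (suc y) ≡ true → y ≡ j
prependPair-partner-unique j Q = addSingleton-singleton j Q

prependPair-punchIn : ∀ j (Q : BoolRel (Fin n)) a b → prependPair j Q (suc (punchIn j a)) (suc (punchIn j b)) ≡ Q a b
prependPair-punchIn j Q = delete-insert j (λ _ → false) Q

insert-injective : ∀ p {b b′ : Fin n → Bool} {P P′} → insert p b P ≗₂ insert p b′ P′ → P ≗₂ P′
insert-injective p {b} {b′} {P} {P′} eq x y =
  trans (sym (delete-insert p b P x y)) (trans (eq (punchIn p x) (punchIn p y)) (delete-insert p b′ P′ x y))

prependPair-injective : ∀ {j j′ : Fin (suc n)} {Q Q′} →
  prependPair j Q ≗₂ prependPair j′ Q′ → j ≡ j′ × Q ≗₂ Q′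
prependPair-injective {j = j} {j′} {Q} {Q′} eq
  with prependPair-partner-unique j Q (trans (eq zero (suc j′)) (prependPair-partner j′ Q′))
... | refl = refl , insert-injective j (insert-injective zero eq)

partner? : (P : BoolRel (Fin (suc n))) (p : Fin (suc n)) → Dec (∃ λ i → P p (punchIn p i) ≡ true)
partner? P p = any? (λ i → P p (punchIn p i) ≟ᵇ true)

no-partner : ∀ {P : BoolRel (Fin (suc n))} {p} →
  ¬ (∃ λ i → P p (punchIn p i) ≡ true) → ∀ i → P p (punchIn p i) ≡ false
no-partner lonely i = ¬-not (lonely ∘ (i ,_))

module _ {P : BoolRel (Fin (suc n))} (isP : IsPartition P) where

  addSingleton-delete : ∀ p {Q} → Q ≗₂ delete p P → (∀ i → P p (punchIn p i) ≡ false) →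
    addSingleton p Q ≗₂ P
  addSingleton-delete p Q≗ lonely x y =
    trans (insert-cong p (λ i → sym (lonely i)) Q≗ x y) (insert-delete p isP x y)

  prependTo-delete : ∀ j {Q} → Q ≗₂ delete zero P → P zero (suc j) ≡ true → prependTo j Q ≗₂ P
  prependTo-delete j Q≗ 0~j x y =
    trans (insert-cong zero (λ i → trans (Q≗ j i) (sym (related-rows isP (suc i) 0~j))) Q≗ x y)
          (insert-delete zero isP x y)

prependPair-delete : ∀ {P : BoolRel (Fin (suc (suc n)))} {Q} j → IsPartition P → Q ≗₂ delete j (delete zero P) →
  P zero (suc j) ≡ true → (∀ i → P (suc j) (suc (punchIn j i)) ≡ false) → prependPair j Q ≗₂ P
prependPair-delete j isP Q≗ 0~j lonely =
  prependTo-delete isP j (addSingleton-delete (delete-isPartition zero isP) j Q≗ lonely) 0~j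

matching-partner-lonely : ∀ {P : BoolRel (Fin (suc (suc n)))} {j} → IsPartition P → IsMatching P →
  P zero (suc j) ≡ true → ∀ i → P (suc j) (suc (punchIn j i)) ≡ false
matching-partner-lonely {j = j} isP isM 0~j i = ¬-not λ j~i →
  case isM zero (suc j) (suc (punchIn j i)) 0~j (transitive isP _ _ _ 0~j j~i) of λ where
    (inj₂ (inj₂ j≡i)) → punchInᵢ≢i j i (sym (suc-injective j≡i))

-- Avoiding 1/234

-- The occurrences of 1/234 are the x < a < b < c with a, b, c in one block and x outside it.
Avoids-1/234 : BoolRel (Fin n) → Set
Avoids-1/234 P = ∀ x a b c → x < a → a < b → b < c → P a b ≡ true → P b c ≡ true → P x a ≡ true

NoIncreasingTriple : BoolRel (Fin n) → Set
NoIncreasingTriple P = ∀ a b c → a < b → b < c → P a b ≡ true → P b c ≡ true → ⊥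

module _ {P : BoolRel (Fin n)} (isP : IsPartition P) where

  isMatching⇒noIncreasingTriple : IsMatching P → NoIncreasingTriple P
  isMatching⇒noIncreasingTriple isM a b c a<b b<c ab bc with isM b a c (symmetric isP a b ab) bc
  ... | inj₁ b≡a        = <-irrefl (sym b≡a) a<b
  ... | inj₂ (inj₁ b≡c) = <-irrefl b≡c b<c
  ... | inj₂ (inj₂ a≡c) = <-irrefl a≡c (<-trans a<b b<c)

  noIncreasingTriple⇒isMatching : NoIncreasingTriple P → IsMatching P
  noIncreasingTriple⇒isMatching noTriple x y z xy xz with x ≟ y | x ≟ z | y ≟ z
  ... | yes x≡y | _       | _       = inj₁ x≡y
  ... | no _    | yes x≡z | _       = inj₂ (inj₁ x≡z)
  ... | no _    | no _    | yes y≡z = inj₂ (inj₂ y≡z)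
  ... | no x≢y  | no x≢z  | no y≢z  = contradiction (<-cmp x y , <-cmp y z , <-cmp x z) sorted
    where
    yz = transitive isP y x z (symmetric isP x y xy) xz
    yx = symmetric isP x y xy
    zx = symmetric isP x z xz
    zy = symmetric isP y z yz
    sorted : Tri (x < y) (x ≡ y) (y < x) × Tri (y < z) (y ≡ z) (z < y) × Tri (x < z) (x ≡ z) (z < x) → ⊥
    sorted (tri≈ _ x≡y _ , _ , _) = x≢y x≡y
    sorted (_ , tri≈ _ y≡z _ , _) = y≢z y≡z
    sorted (_ , _ , tri≈ _ x≡z _) = x≢z x≡z
    sorted (tri< x<y _ _ , tri< y<z _ _ , _)           = noTriple x y z x<y y<z xy yz
    sorted (tri< x<y _ _ , tri> _ _ z<y , tri< x<z _ _) = noTriple x z y x<z z<y xz zy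
    sorted (tri< x<y _ _ , tri> _ _ z<y , tri> _ _ z<x) = noTriple z x y z<x x<y zx xy
    sorted (tri> _ _ y<x , tri< y<z _ _ , tri< x<z _ _) = noTriple y x z y<x x<z yx xz
    sorted (tri> _ _ y<x , tri< y<z _ _ , tri> _ _ z<x) = noTriple y z x y<z z<x yz zx
    sorted (tri> _ _ y<x , tri> _ _ z<y , _)           = noTriple z y x z<y y<x zy yx

prepend-matching-avoids : ∀ b {Q : BoolRel (Fin n)} → IsPartition Q → IsMatching Q → Avoids-1/234 (insert zero b Q)
prepend-matching-avoids b isQ isM x (suc a) (suc b′) (suc c) _ (s≤s a<b) (s≤s b<c) ab bc =
  ⊥-elim (isMatching⇒noIncreasingTriple isQ isM a b′ c a<b b<c ab bc)

prependTo-zero-avoids : ∀ {P : BoolRel (Fin (suc n))} → IsPartition P → Avoids-1/234 P →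
  Avoids-1/234 (prependTo zero P)
prependTo-zero-avoids isP av zero (suc zero) (suc b) (suc c) _ _ _ ab bc = reflexive isP zero
prependTo-zero-avoids isP av zero (suc (suc a)) (suc b) (suc c) _ (s≤s a<b) (s≤s b<c) ab bc =
  av zero (suc a) b c (s≤s z≤n) a<b b<c ab bc
prependTo-zero-avoids isP av (suc x) (suc a) (suc b) (suc c) (s≤s x<a) (s≤s a<b) (s≤s b<c) ab bc =
  av x a b c x<a a<b b<c ab bc

delete-zero-avoids : ∀ {P : BoolRel (Fin (suc n))} → Avoids-1/234 P → Avoids-1/234 (delete zero P)
delete-zero-avoids av x a b c x<a a<b b<c = av (suc x) (suc a) (suc b) (suc c) (s≤s x<a) (s≤s a<b) (s≤s b<c)

delete-zero-isMatching : ∀ {P : BoolRel (Fin (suc (suc n)))} → IsPartition P → Avoids-1/234 P →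
  P zero (suc zero) ≡ false → IsMatching (delete zero P)
delete-zero-isMatching {P = P} isP av 0≁1 = noIncreasingTriple⇒isMatching (on-isPartition suc isP) noTriple
  where
  noTriple : NoIncreasingTriple (delete zero P)
  noTriple zero    b c a<b b<c ab bc =
    not-¬ 0≁1 (av zero (suc zero) (suc b) (suc c) (s≤s z≤n) (s≤s a<b) (s≤s b<c) ab bc)
  noTriple (suc a) b c a<b b<c ab bc with P (suc zero) (suc (suc a)) in 1~a
  ... | true  =
    not-¬ 0≁1 (av zero (suc zero) (suc (suc a)) (suc b) (s≤s z≤n) (s≤s (s≤s z≤n)) (s≤s a<b) 1~a ab)
  ... | false =
    not-¬ 1~a (av (suc zero) (suc (suc a)) (suc b) (suc c) (s≤s (s≤s z≤n)) (s≤s a<b) (s≤s b<c) ab bc)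

-- Codes for matchings

⊎-injective : ∀ {X : Set} {_≈_ : X → X → Set} {f : A ⊎ B → X} →
  Injective _≡_ _≈_ (f ∘ inj₁) → Injective _≡_ _≈_ (f ∘ inj₂) →
  (∀ {a b} → ¬ f (inj₁ a) ≈ f (inj₂ b)) → (∀ {a b} → ¬ f (inj₂ b) ≈ f (inj₁ a)) →
  Injective _≡_ _≈_ f
⊎-injective f₁-inj f₂-inj apart₁₂ apart₂₁ {inj₁ a} {inj₁ a′} eq = cong inj₁ (f₁-inj eq)
⊎-injective f₁-inj f₂-inj apart₁₂ apart₂₁ {inj₁ a} {inj₂ b}  eq = ⊥-elim (apart₁₂ eq)
⊎-injective f₁-inj f₂-inj apart₁₂ apart₂₁ {inj₂ b} {inj₁ a}  eq = ⊥-elim (apart₂₁ eq)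
⊎-injective f₁-inj f₂-inj apart₁₂ apart₂₁ {inj₂ b} {inj₂ b′} eq = cong inj₂ (f₂-inj eq)

MatchingCode : ℕ → Set
MatchingCode zero          = ⊤
MatchingCode (suc zero)    = ⊤
MatchingCode (suc (suc n)) = MatchingCode (suc n) ⊎ (Fin (suc n) × MatchingCode n)

matching : MatchingCode n → BoolRel (Fin n)
matching {zero}        _              = λ ()
matching {suc zero}    _              = prependSingleton (λ ())
matching {suc (suc n)} (inj₁ c)       = prependSingleton (matching c)
matching {suc (suc n)} (inj₂ (j , c)) = prependPair j (matching c)

matching-isPartition : ∀ (c : MatchingCode n) → IsPartition (matching c)
matching-isPartition {zero}        _              = empty-isPartition _
matching-isPartition {suc zero}    _              = addSingleton-isPartition zero (empty-isPartition _)
matching-isPartition {suc (suc n)} (inj₁ c)       = addSingleton-isPartition zero (matching-isPartition c)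
matching-isPartition {suc (suc n)} (inj₂ (j , c)) = prependPair-isPartition j (matching-isPartition c)

matching-isMatching : ∀ (c : MatchingCode n) → IsMatching (matching c)
matching-isMatching {zero}        _              ()
matching-isMatching {suc zero}    _              = addSingleton-isMatching zero λ ()
matching-isMatching {suc (suc n)} (inj₁ c)       = addSingleton-isMatching zero (matching-isMatching c)
matching-isMatching {suc (suc n)} (inj₂ (j , c)) = prependPair-isMatching j (matching-isMatching c)

matching-complete : ∀ {P : BoolRel (Fin n)} → IsPartition P → IsMatching P → ∃ λ c → matching c ≗₂ P
matching-complete {zero}  isP isM = tt , λ ()
matching-complete {suc n} {P} isP isM with partner? P zero
matching-complete {suc zero}    isP isM | no _ = tt , addSingleton-delete isP zero (λ ()) (λ ())
matching-complete {suc (suc n)} {P} isP isM | no lonely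
  with c , c≗ ← matching-complete (delete-isPartition zero isP) (delete-isMatching zero isM)
  = inj₁ c , addSingleton-delete isP zero c≗ (no-partner {P = P} lonely)
matching-complete {suc (suc n)} isP isM | yes (j , 0~j)
  with c , c≗ ← matching-complete (delete-isPartition j (delete-isPartition zero isP))
                                  (delete-isMatching j (delete-isMatching zero isM))
  = inj₂ (j , c) , prependPair-delete j isP c≗ 0~j (matching-partner-lonely isP isM 0~j)

matching-injective : Injective _≡_ _≗₂_ (matching {n})
matching-injective {zero}        _ = refl
matching-injective {suc zero}    _ = refl
matching-injective {suc (suc n)} = ⊎-injective {_≈_ = _≗₂_} {f = matching}
  (matching-injective ∘ insert-injective zero)
  (λ eq → let j≡j′ , c≗c′ = prependPair-injective eq in cong₂ _,_ j≡j′ (matching-injective c≗c′))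
  (λ { {_} {j , c} eq → not-¬ (sym (eq zero (suc j))) (prependPair-partner j (matching c)) })
  (λ { {_} {j , c} eq → not-¬ (eq zero (suc j)) (prependPair-partner j (matching c)) })

-- A marked pair is represented by either of its elements; _≈ᵐ_ identifies the two choices.
Marked : ℕ → Set
Marked n = BoolRel (Fin n) × Fin n

_≈ᵐ_ : Marked n → Marked n → Set
(P , x) ≈ᵐ (Q , y) = P ≗₂ Q × P x y ≡ true

record IsMarkedMatching (P : BoolRel (Fin n)) (x : Fin n) : Set where
  field
    isPartition : IsPartition P
    isMatching  : IsMatching P
    partner     : Fin n
    partner≢    : partner ≢ x
    partnered   : P x partner ≡ true

open IsMarkedMatching

prependSingletonᵐ : Marked n → Marked (suc n)
prependSingletonᵐ (P , x) = prependSingleton P , suc x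

prependPairᵐ : Fin (suc n) → Marked n → Marked (suc (suc n))
prependPairᵐ j (P , x) = prependPair j P , suc (punchIn j x)

module _ {P : BoolRel (Fin n)} {x} (mm : IsMarkedMatching P x) where

  prependSingleton-isMarkedMatching : IsMarkedMatching (prependSingleton P) (suc x)
  prependSingleton-isMarkedMatching = record
    { isPartition = addSingleton-isPartition zero (isPartition mm)
    ; isMatching  = addSingleton-isMatching zero (isMatching mm)
    ; partner     = suc (partner mm)
    ; partner≢    = partner≢ mm ∘ suc-injective
    ; partnered   = partnered mm
    }

  prependPair-isMarkedMatching : ∀ j → IsMarkedMatching (prependPair j P) (suc (punchIn j x))
  prependPair-isMarkedMatching j = record
    { isPartition = prependPair-isPartition j (isPartition mm)
    ; isMatching  = prependPair-isMatching j (isMatching mm)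
    ; partner     = suc (punchIn j (partner mm))
    ; partner≢    = partner≢ mm ∘ punchIn-injective j _ _ ∘ suc-injective
    ; partnered   = trans (prependPair-punchIn j P x (partner mm)) (partnered mm)
    }

prependPair-zero-isMarkedMatching : ∀ j {Q : BoolRel (Fin n)} → IsPartition Q → IsMatching Q →
  IsMarkedMatching (prependPair j Q) zero
prependPair-zero-isMarkedMatching j {Q} isQ isM = record
  { isPartition = prependPair-isPartition j isQ
  ; isMatching  = prependPair-isMatching j isM
  ; partner     = suc j
  ; partner≢    = λ ()
  ; partnered   = prependPair-partner j Q
  }

-- FirstUnmarkedCode n codes the marked matchings of a (1+n)-element set whose first element is unmarked.
mutual
  MarkedCode : ℕ → Set
  MarkedCode zero          = ⊥
  MarkedCode (suc zero)    = ⊥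
  MarkedCode (suc (suc n)) = FirstUnmarkedCode (suc n) ⊎ (Fin (suc n) × MatchingCode n)

  FirstUnmarkedCode : ℕ → Set
  FirstUnmarkedCode zero    = ⊥
  FirstUnmarkedCode (suc n) = MarkedCode (suc n) ⊎ (Fin (suc n) × MarkedCode n)

mutual
  marked : MarkedCode n → Marked n
  marked {suc (suc n)} (inj₁ u)       = firstUnmarked u
  marked {suc (suc n)} (inj₂ (j , c)) = prependPair j (matching c) , zero

  firstUnmarked : FirstUnmarkedCode n → Marked (suc n)
  firstUnmarked {suc n} (inj₁ c)       = prependSingletonᵐ (marked c)
  firstUnmarked {suc n} (inj₂ (j , c)) = prependPairᵐ j (marked c)

mutual
  marked-isMarkedMatching : ∀ (c : MarkedCode n) → uncurry IsMarkedMatching (marked c)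
  marked-isMarkedMatching {suc (suc n)} (inj₁ u)       = firstUnmarked-isMarkedMatching u
  marked-isMarkedMatching {suc (suc n)} (inj₂ (j , c)) =
    prependPair-zero-isMarkedMatching j (matching-isPartition c) (matching-isMatching c)

  firstUnmarked-isMarkedMatching : ∀ (u : FirstUnmarkedCode n) → uncurry IsMarkedMatching (firstUnmarked u)
  firstUnmarked-isMarkedMatching {suc n} (inj₁ c)       = prependSingleton-isMarkedMatching (marked-isMarkedMatching c)
  firstUnmarked-isMarkedMatching {suc n} (inj₂ (j , c)) = prependPair-isMarkedMatching (marked-isMarkedMatching c) j

firstUnmarked-unmarked : ∀ (u : FirstUnmarkedCode n) → uncurry (λ P x → P x zero ≡ false) (firstUnmarked u)
firstUnmarked-unmarked {suc n} (inj₁ c)       = refl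
firstUnmarked-unmarked {suc n} (inj₂ (j , c)) = insert-row j (λ _ → false) (proj₁ (marked c)) (proj₂ (marked c))

markedBlock-zero-partner : ∀ {P : BoolRel (Fin (suc n))} {x} → IsMarkedMatching P x → P x zero ≡ true →
  ∃ λ j → P zero (suc j) ≡ true
markedBlock-zero-partner {x = zero} mm _ with partner mm | partner≢ mm | partnered mm
... | zero  | p≢x | _   = ⊥-elim (p≢x refl)
... | suc y | _   | 0~y = y , 0~y
markedBlock-zero-partner {x = suc x} mm x~0 = x , symmetric (isPartition mm) (suc x) zero x~0

delete-zero-isMarkedMatching : ∀ {P : BoolRel (Fin (suc n))} {x} → IsMarkedMatching P (suc x) →
  P (suc x) zero ≡ false → IsMarkedMatching (delete zero P) x
delete-zero-isMarkedMatching mm x≁0 with partner mm | partner≢ mm | partnered mm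
... | zero  | _   | x~0 = ⊥-elim (not-¬ x≁0 x~0)
... | suc y | y≢x | x~y = record
  { isPartition = delete-isPartition zero (isPartition mm)
  ; isMatching  = delete-isMatching zero (isMatching mm)
  ; partner     = y
  ; partner≢    = y≢x ∘ cong suc
  ; partnered   = x~y
  }

delete-pair-isMarkedMatching : ∀ {P : BoolRel (Fin (suc (suc n)))} {j x} → IsMarkedMatching P (suc (punchIn j x)) →
  P zero (suc j) ≡ true → P (suc (punchIn j x)) zero ≡ false → IsMarkedMatching (delete j (delete zero P)) x
delete-pair-isMarkedMatching {j = j} mm 0~j x≁0 with partner mm | partner≢ mm | partnered mm
... | zero  | _   | x~0 = ⊥-elim (not-¬ x≁0 x~0)
... | suc y | y≢x | x~y with punchView j y
...   | at         = ⊥-elim (not-¬ x≁0 (transitive isP _ _ _ x~y (symmetric isP _ _ 0~j)))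
  where isP = isPartition mm
...   | punched y″ = record
  { isPartition = delete-isPartition j (delete-isPartition zero (isPartition mm))
  ; isMatching  = delete-isMatching j (delete-isMatching zero (isMatching mm))
  ; partner     = y″
  ; partner≢    = y≢x ∘ cong (suc ∘ punchIn j)
  ; partnered   = x~y
  }

mutual
  marked-complete : ∀ {P : BoolRel (Fin n)} {x} → IsMarkedMatching P x → ∃ λ c → marked c ≈ᵐ (P , x)
  marked-complete {zero} {x = ()}
  marked-complete {suc n} {P} {x} mm with P x zero in x~0
  marked-complete {suc zero} {x = zero} mm | _ with partner mm | partner≢ mm
  ... | zero | p≢x = ⊥-elim (p≢x refl)
  marked-complete {suc (suc n)} mm | false with u , u≈ ← firstUnmarked-complete mm x~0 = inj₁ u , u≈
  marked-complete {suc (suc n)} {P} {x} mm | true with partner? P zero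
  ... | no lonely = ⊥-elim (lonely (markedBlock-zero-partner mm x~0))
  ... | yes (j , 0~j)
    with c , c≗ ← matching-complete (delete-isPartition j (delete-isPartition zero (isPartition mm)))
                                    (delete-isMatching j (delete-isMatching zero (isMatching mm)))
    = inj₂ (j , c) , P≗ , trans (P≗ zero x) (symmetric (isPartition mm) x zero x~0)
    where
    P≗ = prependPair-delete j (isPartition mm) c≗ 0~j (matching-partner-lonely (isPartition mm) (isMatching mm) 0~j)

  firstUnmarked-complete : ∀ {P : BoolRel (Fin (suc n))} {x} → IsMarkedMatching P x → P x zero ≡ false →
    ∃ λ u → firstUnmarked u ≈ᵐ (P , x)
  firstUnmarked-complete {x = zero} mm 0≁0 = ⊥-elim (not-¬ 0≁0 (reflexive (isPartition mm) zero))
  firstUnmarked-complete {n} {P} {suc x} mm x≁0 with partner? P zero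
  firstUnmarked-complete {suc n} {P} {suc x} mm x≁0 | no lonely
    with c , Q≗ , m~x ← marked-complete (delete-zero-isMarkedMatching mm x≁0)
    = inj₁ c , addSingleton-delete (isPartition mm) zero Q≗ (no-partner {P = P} lonely) , m~x
  firstUnmarked-complete {suc n} {P} {suc x} mm x≁0 | yes (j , 0~j) with punchView j x
  ... | at = ⊥-elim (not-¬ x≁0 (symmetric (isPartition mm) zero (suc j) 0~j))
  ... | punched x″ with c , Q≗ , m~x ← marked-complete (delete-pair-isMarkedMatching mm 0~j x≁0)
    = inj₂ (j , c) , P≗ , trans (prependPair-punchIn j _ _ x″) m~x
    where
    P≗ = prependPair-delete j (isPartition mm) Q≗ 0~j (matching-partner-lonely (isPartition mm) (isMatching mm) 0~j)

prependPairᵐ-injective : ∀ {j j′ : Fin (suc n)} {m m′ : Marked n} →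
  prependPairᵐ j m ≈ᵐ prependPairᵐ j′ m′ → j ≡ j′ × m ≈ᵐ m′
prependPairᵐ-injective {j = j} {j′} {m = P , x} {P′ , x′} (P≗ , x~x′)
  with prependPair-injective {j = j} {j′} P≗
... | refl , Q≗ = refl , Q≗ , trans (sym (prependPair-punchIn j P x x′)) x~x′

mutual
  marked-injective : Injective _≡_ _≈ᵐ_ (marked {n})
  marked-injective {suc (suc n)} = ⊎-injective {_≈_ = _≈ᵐ_} {f = marked}
    firstUnmarked-injective
    (λ (P≗ , _) → let j≡j′ , c≗c′ = prependPair-injective P≗
                   in cong₂ _,_ j≡j′ (matching-injective c≗c′))
    (λ { {u} (_ , x~0) → not-¬ (firstUnmarked-unmarked u) x~0 })
    (λ { {u} (P≗ , 0~x) → not-¬ (firstUnmarked-unmarked u)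
           (symmetric (isPartition (firstUnmarked-isMarkedMatching u)) _ _ (trans (sym (P≗ zero _)) 0~x)) })

  firstUnmarked-injective : Injective _≡_ _≈ᵐ_ (firstUnmarked {n})
  firstUnmarked-injective {suc n} = ⊎-injective {_≈_ = _≈ᵐ_} {f = firstUnmarked}
    (λ (P≗ , x~x′) → marked-injective (insert-injective zero P≗ , x~x′))
    (λ eq → let j≡j′ , m≈m′ = prependPairᵐ-injective eq in cong₂ _,_ j≡j′ (marked-injective m≈m′))
    (λ { {_} {j , c} (P≗ , _) → not-¬ (sym (P≗ zero (suc j))) (prependPair-partner j (proj₁ (marked c))) })
    (λ { {_} {j , c} (P≗ , _) → not-¬ (P≗ zero (suc j)) (prependPair-partner j (proj₁ (marked c))) })

prependToᵐ : Marked n → BoolRel (Fin (suc n))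
prependToᵐ (Q , x) = prependTo x Q

prependToᵐ-injective : ∀ {m m′ : Marked n} → IsPartition (proj₁ m′) →
  prependToᵐ m ≗₂ prependToᵐ m′ → m ≈ᵐ m′
prependToᵐ-injective {m = Q , x} {Q′ , x′} isQ′ eq =
  insert-injective zero eq , trans (eq zero (suc x′)) (reflexive isQ′ x′)

prependPair≉prependTo : ∀ j {Q : BoolRel (Fin n)} {Q′ : BoolRel (Fin (suc n))} {x} →
  IsMarkedMatching Q′ x → ¬ prependPair j Q ≗₂ prependTo x Q′
prependPair≉prependTo j {Q} mm eq =
  partner≢ mm (trans (on-pair (partnered mm)) (sym (on-pair (reflexive (isPartition mm) _))))
  where
  on-pair : ∀ {y} → _ ≡ true → y ≡ j
  on-pair {y} x~y = prependPair-partner-unique j Q (trans (eq zero (suc y)) x~y)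

-- SeparatedCode n codes the avoiders of a (2+n)-element set whose first two elements lie in
-- different blocks: the others form a matching, and the first element is alone, paired with a
-- singleton of it, or joined to a pair of it avoiding the second element. AvoiderCode n codes
-- all avoiders of a (1+n)-element set.
SeparatedCode : ℕ → Set
SeparatedCode n = MatchingCode (suc n) ⊎ ((Fin n × MatchingCode n) ⊎ FirstUnmarkedCode n)

separated : SeparatedCode n → BoolRel (Fin (suc (suc n)))
separated (inj₁ c)              = prependSingleton (matching c)
separated (inj₂ (inj₁ (j , c))) = prependPair (suc j) (matching c)
separated (inj₂ (inj₂ u))       = prependToᵐ (firstUnmarked u)

separated-isPartition : ∀ (s : SeparatedCode n) → IsPartition (separated s)
separated-isPartition (inj₁ c)              = addSingleton-isPartition zero (matching-isPartition c)
separated-isPartition (inj₂ (inj₁ (j , c))) = prependPair-isPartition (suc j) (matching-isPartition c)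
separated-isPartition (inj₂ (inj₂ u))       = prependTo-isPartition _ (isPartition (firstUnmarked-isMarkedMatching u))

separated-avoids : ∀ (s : SeparatedCode n) → Avoids-1/234 (separated s)
separated-avoids (inj₁ c) =
  prepend-matching-avoids _ (matching-isPartition c) (matching-isMatching c)
separated-avoids (inj₂ (inj₁ (j , c))) =
  prepend-matching-avoids _ (addSingleton-isPartition (suc j) (matching-isPartition c))
                               (addSingleton-isMatching (suc j) (matching-isMatching c))
separated-avoids (inj₂ (inj₂ u)) =
  prepend-matching-avoids _ (isPartition mm) (isMatching mm)
  where mm = firstUnmarked-isMarkedMatching u

separated-apart : ∀ (s : SeparatedCode n) → separated s zero (suc zero) ≡ false
separated-apart (inj₁ c)              = refl
separated-apart (inj₂ (inj₁ (j , c))) = ¬-not λ 0~1 → 0≢1+n (addSingleton-singleton (suc j) (matching c) 0~1)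
separated-apart (inj₂ (inj₂ u))       = firstUnmarked-unmarked u

separated-complete : ∀ {P : BoolRel (Fin (suc (suc n)))} → IsPartition P → IsMatching (delete zero P) →
  P zero (suc zero) ≡ false → ∃ λ s → separated s ≗₂ P
separated-complete {P = P} isP tailM 0≁1 with partner? P zero
... | no lonely with c , c≗ ← matching-complete (delete-isPartition zero isP) tailM
  = inj₁ c , addSingleton-delete isP zero c≗ (no-partner {P = P} lonely)
... | yes (zero , 0~1) = ⊥-elim (not-¬ 0≁1 0~1)
... | yes (suc j , 0~j) with partner? (delete zero P) (suc j)
...   | no lonely with c , c≗ ← matching-complete (delete-isPartition (suc j) (delete-isPartition zero isP))
                                                 (delete-isMatching (suc j) tailM)
  = inj₂ (inj₁ (j , c)) , prependPair-delete (suc j) isP c≗ 0~j (no-partner {P = delete zero P} lonely)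
...   | yes (i , j~i) =
  let u , Q≗ , x~j = firstUnmarked-complete tail-marked j≁1
  in inj₂ (inj₂ u) ,
     prependTo-delete isP _ Q≗ (transitive isP _ _ _ 0~j (symmetric isP _ _ (trans (sym (Q≗ _ _)) x~j)))
  where
  tail-marked : IsMarkedMatching (delete zero P) (suc j)
  tail-marked = record
    { isPartition = delete-isPartition zero isP
    ; isMatching  = tailM
    ; partner     = punchIn (suc j) i
    ; partner≢    = punchInᵢ≢i (suc j) i
    ; partnered   = j~i
    }
  j≁1 : P (suc (suc j)) (suc zero) ≡ false
  j≁1 = trans (sym (related-rows isP (suc zero) 0~j)) 0≁1

separated-zero-partner : ∀ (t : (Fin n × MatchingCode n) ⊎ FirstUnmarkedCode n) →
  ∃ λ y → separated (inj₂ t) zero (suc y) ≡ true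
separated-zero-partner (inj₁ (j , c)) = suc j , prependPair-partner (suc j) (matching c)
separated-zero-partner (inj₂ u)       = _ , reflexive (isPartition (firstUnmarked-isMarkedMatching u)) _

separated-injective : Injective _≡_ _≗₂_ (separated {n})
separated-injective = ⊎-injective {_≈_ = _≗₂_} {f = separated}
  (matching-injective ∘ insert-injective zero)
  (⊎-injective {_≈_ = _≗₂_} {f = separated ∘ inj₂}
    (λ eq → let j≡j′ , c≗c′ = prependPair-injective eq
            in cong₂ _,_ (suc-injective j≡j′) (matching-injective c≗c′))
    (λ { {_} {u′} eq →
         firstUnmarked-injective (prependToᵐ-injective (isPartition (firstUnmarked-isMarkedMatching u′)) eq) })
    (λ { {j , _} {u} eq → prependPair≉prependTo (suc j) (firstUnmarked-isMarkedMatching u) eq })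
    (λ { {j , _} {u} eq → prependPair≉prependTo (suc j) (firstUnmarked-isMarkedMatching u) (≗₂-sym eq) }))
  (λ { {_} {t} eq → let y , 0~y = separated-zero-partner t in not-¬ (sym (eq zero (suc y))) 0~y })
  (λ { {_} {t} eq → let y , 0~y = separated-zero-partner t in not-¬ (eq zero (suc y)) 0~y })

AvoiderCode : ℕ → Set
AvoiderCode zero    = ⊤
AvoiderCode (suc n) = AvoiderCode n ⊎ SeparatedCode n

avoider : AvoiderCode n → BoolRel (Fin (suc n))
avoider {zero}  _        = prependSingleton (λ ())
avoider {suc n} (inj₁ c) = prependTo zero (avoider c)
avoider {suc n} (inj₂ s) = separated s

avoider-isPartition : ∀ (c : AvoiderCode n) → IsPartition (avoider c)
avoider-isPartition {zero}  _        = addSingleton-isPartition zero (empty-isPartition _)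
avoider-isPartition {suc n} (inj₁ c) = prependTo-isPartition zero (avoider-isPartition c)
avoider-isPartition {suc n} (inj₂ s) = separated-isPartition s

avoider-avoids : ∀ (c : AvoiderCode n) → Avoids-1/234 (avoider c)
avoider-avoids {zero}  _        = prepend-matching-avoids _ (empty-isPartition _) λ ()
avoider-avoids {suc n} (inj₁ c) = prependTo-zero-avoids (avoider-isPartition c) (avoider-avoids c)
avoider-avoids {suc n} (inj₂ s) = separated-avoids s

avoider-complete : ∀ {P : BoolRel (Fin (suc n))} → IsPartition P → Avoids-1/234 P → ∃ λ c → avoider c ≗₂ P
avoider-complete {zero}  isP av = tt , addSingleton-delete isP zero (λ ()) (λ ())
avoider-complete {suc n} {P} isP av with P zero (suc zero) in 0~1
... | true with c , c≗ ← avoider-complete (delete-isPartition zero isP) (delete-zero-avoids av)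
  = inj₁ c , prependTo-delete isP zero c≗ 0~1
... | false with s , s≗ ← separated-complete isP (delete-zero-isMatching isP av 0~1) 0~1
  = inj₂ s , s≗

avoider-injective : Injective _≡_ _≗₂_ (avoider {n})
avoider-injective {zero}  _ = refl
avoider-injective {suc n} = ⊎-injective {_≈_ = _≗₂_} {f = avoider}
  (avoider-injective ∘ insert-injective zero)
  separated-injective
  (λ { {c} {s} eq → not-¬ (separated-apart s)
                           (trans (sym (eq zero (suc zero))) (reflexive (avoider-isPartition c) zero)) })
  (λ { {c} {s} eq → not-¬ (separated-apart s) (trans (eq zero (suc zero)) (reflexive (avoider-isPartition c) zero)) })

-- Counting the codes

record Enumeration (A : Set) : Set where
  field
    list     : List A
    unique   : Unique list
    complete : ∀ x → x ∈ list

open Enumeration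

size : Enumeration A → ℕ
size e = length (list e)

⊤-enumeration : Enumeration ⊤
⊤-enumeration = record { list = tt ∷ [] ; unique = [] ∷ [] ; complete = λ _ → here refl }

⊥-enumeration : Enumeration ⊥
⊥-enumeration = record { list = [] ; unique = [] ; complete = λ () }

Fin-enumeration : ∀ n → Enumeration (Fin n)
Fin-enumeration n = record { list = allFin n ; unique = allFin⁺ n ; complete = ∈-allFin }

⊎-enumeration : Enumeration A → Enumeration B → Enumeration (A ⊎ B)
⊎-enumeration eA eB = record
  { list     = map inj₁ (list eA) ++ map inj₂ (list eB)
  ; unique   = ++⁺ (map⁺ inj₁-injective (unique eA)) (map⁺ inj₂-injective (unique eB)) disjoint
  ; complete = λ where
      (inj₁ a) → ∈-++⁺ˡ (∈-map⁺ inj₁ (complete eA a))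
      (inj₂ b) → ∈-++⁺ʳ (map inj₁ (list eA)) (∈-map⁺ inj₂ (complete eB b))
  }
  where
  disjoint : ∀ {v} → ¬ (v ∈ map inj₁ (list eA) × v ∈ map inj₂ (list eB))
  disjoint (v∈₁ , v∈₂) with ∈-map⁻ inj₁ v∈₁ | ∈-map⁻ inj₂ v∈₂
  ... | _ , _ , refl | _ , _ , ()

×-enumeration : Enumeration A → Enumeration B → Enumeration (A × B)
×-enumeration eA eB = record
  { list     = cartesianProduct (list eA) (list eB)
  ; unique   = cartesianProduct⁺ (unique eA) (unique eB)
  ; complete = λ (a , b) → ∈-cartesianProduct⁺ (complete eA a) (complete eB b)
  }

size-⊎ : ∀ (eA : Enumeration A) (eB : Enumeration B) → size (⊎-enumeration eA eB) ≡ size eA + size eB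
size-⊎ eA eB =
  trans (length-++ (map inj₁ (list eA))) (cong₂ _+_ (length-map inj₁ (list eA)) (length-map inj₂ (list eB)))

length-cartesianProduct : ∀ (xs : List A) (ys : List B) → length (cartesianProduct xs ys) ≡ length xs * length ys
length-cartesianProduct []       ys = refl
length-cartesianProduct (x ∷ xs) ys =
  trans (length-++ (map (x ,_) ys)) (cong₂ _+_ (length-map (x ,_) ys) (length-cartesianProduct xs ys))

size-Fin× : ∀ n (e : Enumeration A) → size (×-enumeration (Fin-enumeration n) e) ≡ n * size e
size-Fin× n e =
  trans (length-cartesianProduct (allFin n) (list e)) (cong (_* size e) (length-tabulate {n = n} (λ i → i)))

size-⊎-Fin× : ∀ (eA : Enumeration A) k (eB : Enumeration B) →
  size (⊎-enumeration eA (×-enumeration (Fin-enumeration k) eB)) ≡ size eA + k * size eB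
size-⊎-Fin× eA k eB = trans (size-⊎ eA (×-enumeration (Fin-enumeration k) eB)) (cong (size eA +_) (size-Fin× k eB))

matchingCodes : ∀ n → Enumeration (MatchingCode n)
matchingCodes zero          = ⊤-enumeration
matchingCodes (suc zero)    = ⊤-enumeration
matchingCodes (suc (suc n)) =
  ⊎-enumeration (matchingCodes (suc n)) (×-enumeration (Fin-enumeration (suc n)) (matchingCodes n))

size-matchingCodes : ∀ n → size (matchingCodes n) ≡ M n
size-matchingCodes zero          = refl
size-matchingCodes (suc zero)    = refl
size-matchingCodes (suc (suc n)) = begin
  size (matchingCodes (suc (suc n)))
    ≡⟨ size-⊎-Fin× (matchingCodes (suc n)) (suc n) (matchingCodes n) ⟩
  size (matchingCodes (suc n)) + suc n * size (matchingCodes n)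
    ≡⟨ cong₂ (λ a b → a + suc n * b) (size-matchingCodes (suc n)) (size-matchingCodes n) ⟩
  M (suc n) + suc n * M n
    ≡⟨ M-rec n ⟨
  M (suc (suc n)) ∎
  where open ≡-Reasoning

mutual
  markedCodes : ∀ n → Enumeration (MarkedCode n)
  markedCodes zero          = ⊥-enumeration
  markedCodes (suc zero)    = ⊥-enumeration
  markedCodes (suc (suc n)) =
    ⊎-enumeration (firstUnmarkedCodes (suc n)) (×-enumeration (Fin-enumeration (suc n)) (matchingCodes n))

  firstUnmarkedCodes : ∀ n → Enumeration (FirstUnmarkedCode n)
  firstUnmarkedCodes zero    = ⊥-enumeration
  firstUnmarkedCodes (suc n) =
    ⊎-enumeration (markedCodes (suc n)) (×-enumeration (Fin-enumeration (suc n)) (markedCodes n))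

mutual
  size-markedCodes : ∀ n → size (markedCodes n) ≡ (n C 2) * M (n ∸ 2)
  size-markedCodes zero          = refl
  size-markedCodes (suc zero)    = refl
  size-markedCodes (suc (suc n)) = begin
    size (markedCodes (suc (suc n)))
      ≡⟨ size-⊎-Fin× (firstUnmarkedCodes (suc n)) (suc n) (matchingCodes n) ⟩
    size (firstUnmarkedCodes (suc n)) + suc n * size (matchingCodes n)
      ≡⟨ cong₂ (λ a b → a + suc n * b) (size-firstUnmarkedCodes (suc n)) (size-matchingCodes n) ⟩
    (suc n C 2) * M n + suc n * M n
      ≡⟨ *-distribʳ-+ (M n) (suc n C 2) (suc n) ⟨
    (suc n C 2 + suc n) * M n
      ≡⟨ cong (_* M n) (trans (+-comm (suc n C 2) (suc n)) (sym ([1+n]C2≡n+nC2 (suc n)))) ⟩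
    (suc (suc n) C 2) * M n ∎
    where open ≡-Reasoning

  size-firstUnmarkedCodes : ∀ n → size (firstUnmarkedCodes n) ≡ (n C 2) * M (n ∸ 1)
  size-firstUnmarkedCodes zero    = refl
  size-firstUnmarkedCodes (suc n) = begin
    size (firstUnmarkedCodes (suc n))
      ≡⟨ size-⊎-Fin× (markedCodes (suc n)) (suc n) (markedCodes n) ⟩
    size (markedCodes (suc n)) + suc n * size (markedCodes n)
      ≡⟨ cong₂ (λ a b → a + suc n * b) (size-markedCodes (suc n)) (size-markedCodes n) ⟩
    (suc n C 2) * M (n ∸ 1) + suc n * ((n C 2) * M (n ∸ 2))
      ≡⟨ firstUnmarked-count n ⟩
    (suc n C 2) * M n ∎
    where open ≡-Reasoning

separatedCodes : ∀ n → Enumeration (SeparatedCode n)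
separatedCodes n = ⊎-enumeration (matchingCodes (suc n))
  (⊎-enumeration (×-enumeration (Fin-enumeration n) (matchingCodes n)) (firstUnmarkedCodes n))

size-separatedCodes : ∀ n → size (separatedCodes n) ≡ M (suc n) + (n * M n + (n C 2) * M (n ∸ 1))
size-separatedCodes n = begin
  size (separatedCodes n)
    ≡⟨ size-⊎ (matchingCodes (suc n)) (⊎-enumeration pairs (firstUnmarkedCodes n)) ⟩
  size (matchingCodes (suc n)) + size (⊎-enumeration pairs (firstUnmarkedCodes n))
    ≡⟨ cong (size (matchingCodes (suc n)) +_) (size-⊎ pairs (firstUnmarkedCodes n)) ⟩
  size (matchingCodes (suc n)) + (size pairs + size (firstUnmarkedCodes n))
    ≡⟨ cong₂ (λ a b → a + (b + size (firstUnmarkedCodes n)))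
             (size-matchingCodes (suc n)) (size-Fin× n (matchingCodes n)) ⟩
  M (suc n) + (n * size (matchingCodes n) + size (firstUnmarkedCodes n))
    ≡⟨ cong₂ (λ a b → M (suc n) + (n * a + b)) (size-matchingCodes n) (size-firstUnmarkedCodes n) ⟩
  M (suc n) + (n * M n + (n C 2) * M (n ∸ 1)) ∎
  where
  open ≡-Reasoning
  pairs = ×-enumeration (Fin-enumeration n) (matchingCodes n)

avoiderCodes : ∀ n → Enumeration (AvoiderCode n)
avoiderCodes zero    = ⊤-enumeration
avoiderCodes (suc n) = ⊎-enumeration (avoiderCodes n) (separatedCodes n)

size-avoiderCodes : ∀ n → size (avoiderCodes n) ≡ RHS (suc n)
size-avoiderCodes zero    = refl
size-avoiderCodes (suc n) = begin
  size (avoiderCodes (suc n))                       ≡⟨ size-⊎ (avoiderCodes n) (separatedCodes n) ⟩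
  size (avoiderCodes n) + size (separatedCodes n)   ≡⟨ cong₂ _+_ (size-avoiderCodes n) (size-separatedCodes n) ⟩
  RHS (suc n) + (M (suc n) + (n * M n + (n C 2) * M (n ∸ 1))) ≡⟨ RHS-rec n ⟩
  RHS (suc (suc n))                                 ∎
  where open ≡-Reasoning

toRel : BoolRel (Fin n) → Rel n
toRel P = tabulate (λ i → tabulate (P i))

rel-toRel : ∀ (P : BoolRel (Fin n)) → rel (toRel P) ≗₂ P
rel-toRel P i j =
  trans (cong (λ row → lookup row j) (lookup∘tabulate (λ i → tabulate (P i)) i)) (lookup∘tabulate (P i) j)

toRel-rel : ∀ (R : Rel n) {P} → P ≗₂ rel R → toRel P ≡ R
toRel-rel R P≗ =
  trans (tabulate-cong λ i → trans (tabulate-cong (P≗ i)) (tabulate∘lookup (lookup R i))) (tabulate∘lookup R)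

hasCard-by-decoding : ∀ {C : Set} {Good : Rel n → Set} (e : Enumeration C) (decode : C → BoolRel (Fin n)) →
  Injective _≡_ _≗₂_ decode → (∀ c → Good (toRel (decode c))) →
  (∀ R → Good R → ∃ λ c → decode c ≗₂ rel R) → HasCard Good (size e)
hasCard-by-decoding {Good = Good} e decode decode-injective decode-sound decode-complete =
    map (toRel ∘ decode) (list e)
  , map⁺ toRel-injective (unique e)
  , (λ R → mk⇔ (from R) (to R))
  , length-map (toRel ∘ decode) (list e)
  where
  toRel-injective : Injective _≡_ _≡_ (toRel ∘ decode)
  toRel-injective {c} {c′} eq = decode-injective λ i j →
    trans (sym (rel-toRel (decode c) i j)) (trans (cong (λ R → rel R i j) eq) (rel-toRel (decode c′) i j))
  from : ∀ R → R ∈ map (toRel ∘ decode) (list e) → Good R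
  from R R∈ with c , _ , refl ← ∈-map⁻ (toRel ∘ decode) R∈ = decode-sound c
  to : ∀ R → Good R → R ∈ map (toRel ∘ decode) (list e)
  to R good with c , c≗ ← decode-complete R good =
    subst (_∈ _) (toRel-rel R c≗) (∈-map⁺ (toRel ∘ decode) (complete e c))

isPartition-resp : ∀ {P Q : BoolRel (Fin n)} → P ≗₂ Q → IsPartition P → IsPartition Q
isPartition-resp P≗Q isP = record
  { reflexive  = λ x → trans (sym (P≗Q x x)) (reflexive isP x)
  ; symmetric  = λ x y xy → trans (sym (P≗Q y x)) (symmetric isP x y (trans (P≗Q x y) xy))
  ; transitive = λ x y z xy yz →
      trans (sym (P≗Q x z)) (transitive isP x y z (trans (P≗Q x y) xy) (trans (P≗Q y z) yz))
  }

avoids-resp : ∀ {P Q : BoolRel (Fin n)} → P ≗₂ Q → Avoids-1/234 P → Avoids-1/234 Q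
avoids-resp P≗Q av x a b c x<a a<b b<c ab bc =
  trans (sym (P≗Q x a)) (av x a b c x<a a<b b<c (trans (P≗Q a b) ab) (trans (P≗Q b c) bc))

isSetPartition⇒isPartition : ∀ {R : Rel n} → IsSetPartition R → IsPartition (rel R)
isSetPartition⇒isPartition isSP = record
  { reflexive  = IsSetPartition.reflexive isSP
  ; symmetric  = IsSetPartition.symmetric isSP
  ; transitive = IsSetPartition.transitive isSP
  }

isPartition⇒isSetPartition : ∀ {R : Rel n} → IsPartition (rel R) → IsSetPartition R
isPartition⇒isSetPartition isP = record
  { reflexive = reflexive isP ; symmetric = symmetric isP ; transitive = transitive isP }

avoids-1/234⇒Avoids : ∀ {R : Rel n} → Avoids-1/234 (rel R) → Avoids R p1/234
avoids-1/234⇒Avoids av (s , s-mono , s-eqs) = not-¬ (s-eqs 0F 1F)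
  (av (s 0F) (s 1F) (s 2F) (s 3F) (s-mono 0F 1F (s≤s z≤n)) (s-mono 1F 2F (s≤s (s≤s z≤n)))
      (s-mono 2F 3F (s≤s (s≤s (s≤s z≤n)))) (s-eqs 1F 2F) (s-eqs 2F 3F))

Avoids⇒avoids-1/234 : ∀ {R : Rel n} → IsPartition (rel R) → Avoids R p1/234 → Avoids-1/234 (rel R)
Avoids⇒avoids-1/234 {n} {R} isP avoids x a b c x<a a<b b<c ab bc = ¬-not λ x≁a → avoids (s , s-mono , s-eqs x≁a)
  where
  s : Fin 4 → Fin n
  s 0F = x
  s 1F = a
  s 2F = b
  s 3F = c
  s-mono : ∀ i j → i < j → s i < s j
  s-mono 0F 1F _ = x<a
  s-mono 0F 2F _ = <-trans x<a a<b
  s-mono 0F 3F _ = <-trans x<a (<-trans a<b b<c)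
  s-mono 1F 2F _ = a<b
  s-mono 1F 3F _ = <-trans a<b b<c
  s-mono 2F 3F _ = b<c
  s-mono 1F                  1F (s≤s ())
  s-mono (suc (suc _))       1F (s≤s ())
  s-mono (suc (suc _))       2F (s≤s (s≤s ()))
  s-mono (suc (suc (suc _))) 3F (s≤s (s≤s (s≤s ())))
  ac = transitive isP a b c ab bc
  s-eqs : rel R x a ≡ false → ∀ i j → rel R (s i) (s j) ≡ rel p1/234 i j
  s-eqs x≁a = table
    where
    x≁b = trans (sym (related-columns isP x ab)) x≁a
    x≁c = trans (sym (related-columns isP x ac)) x≁a
    table : ∀ i j → rel R (s i) (s j) ≡ rel p1/234 i j
    table 0F 0F = reflexive isP x
    table 0F 1F = x≁a
    table 0F 2F = x≁b
    table 0F 3F = x≁c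
    table 1F 0F = trans (symmetric-≡ isP a x) x≁a
    table 1F 1F = reflexive isP a
    table 1F 2F = ab
    table 1F 3F = ac
    table 2F 0F = trans (symmetric-≡ isP b x) x≁b
    table 2F 1F = symmetric isP a b ab
    table 2F 2F = reflexive isP b
    table 2F 3F = bc
    table 3F 0F = trans (symmetric-≡ isP c x) x≁c
    table 3F 1F = symmetric isP a c ac
    table 3F 2F = symmetric isP b c bc
    table 3F 3F = reflexive isP c

theorem4p11 : (n : ℕ) → n ≥ 1 → HasCard (InΠ n p1/234) (RHS n)
theorem4p11 (suc n) _ = subst (HasCard (InΠ (suc n) p1/234)) (size-avoiderCodes n)
  (hasCard-by-decoding (avoiderCodes n) avoider avoider-injective decodes-into decodes-onto)
  where
  decodes-into : ∀ c → InΠ (suc n) p1/234 (toRel (avoider c))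
  decodes-into c = isPartition⇒isSetPartition {R = toRel (avoider c)} (isPartition-resp P≗ (avoider-isPartition c))
                  , avoids-1/234⇒Avoids {R = toRel (avoider c)} (avoids-resp P≗ (avoider-avoids c))
    where P≗ = ≗₂-sym (rel-toRel (avoider c))
  decodes-onto : ∀ R → InΠ (suc n) p1/234 R → ∃ λ c → avoider c ≗₂ rel R
  decodes-onto R (isSP , avoids) = avoider-complete isP (Avoids⇒avoids-1/234 {R = R} isP avoids)
    where isP = isSetPartition⇒isPartition isSP
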